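{- Let $(L,<)$ be a linear ordering interpreted in $(\mathbb{N},+)$, given by first-order formulas in the language $\{=,+\}$ defining a domain $D\subseteq\mathbb{N}^m$, an equivalence relation $\sim$ on $D$ (the interpreted equality) and a relation $<_*$ on $D$ (the interpreted order), so that $(D/{\sim},<_*)\cong(L,<)$. Then each of the following unary predicates on $D$ is definable in $(\mathbb{N},+)$: $Z(\bar x)$: the galaxy of (the point represented by) $\bar x$ is order-isomorphic to $\mathbb{Z}$; $N(\bar x)$: its galaxy is order-isomorphic to $\mathbb{N}$; $\overline{N}(\bar x)$: its galaxy is order-isomorphic to $-\mathbb{N}$ (the reverse of $\mathbb{N}$); and, for every positive integer $n$, $F_n(\bar x)$: its galaxy has exactly $n$ elements.
   Context: The galaxy of a point $a$ in a linear ordering $L$ is the set of all points $b\in L$ such that there are only finitely many points of $L$ strictly between $a$ and $b$. -}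

module Defs where

open import Data.Nat using (ℕ; suc; _+_; _≥_)
import Data.Nat as ℕ
open import Data.Integer using (ℤ)
import Data.Integer as ℤ
open import Data.Fin using (Fin)
import Data.Fin as Fin
open import Data.Vec.Functional using (Vector; _∷_; _++_)
open import Data.List using (List)
open import Data.List.Relation.Unary.Any using (Any)
open import Data.Product using (Σ; _×_; _,_)
open import Data.Sum using (_⊎_)
open import Data.Empty using (⊥)
open import Data.Unit using (⊤)
open import Relation.Nullary using (¬_)
open import Relation.Binary.PropositionalEquality using (_≡_)
open import Function.Bundles using (_⇔_)

data Term (n : ℕ) : Set where
  var  : Fin n → Term n
  _⊕_  : Term n → Term n → Term n

data Formula (n : ℕ) : Set where
  _≐_   : Term n → Term n → Formula n
  ⊥ᶠ    : Formula n
  _∧ᶠ_  : Formula n → Formula n → Formula n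
  _∨ᶠ_  : Formula n → Formula n → Formula n
  _⇒ᶠ_  : Formula n → Formula n → Formula n
  ¬ᶠ_   : Formula n → Formula n
  ∃ᶠ    : Formula (suc n) → Formula n
  ∀ᶠ    : Formula (suc n) → Formula n

evalT : ∀ {n} → Term n → Vector ℕ n → ℕ
evalT (var i) ρ = ρ i
evalT (s ⊕ t) ρ = evalT s ρ + evalT t ρ

-- Tarskian satisfaction in (ℕ, +); variable 0 is the innermost bound one.
⟦_⟧ : ∀ {n} → Formula n → Vector ℕ n → Set
⟦ s ≐ t ⟧ ρ = evalT s ρ ≡ evalT t ρ
⟦ ⊥ᶠ ⟧ ρ = ⊥
⟦ φ ∧ᶠ ψ ⟧ ρ = ⟦ φ ⟧ ρ × ⟦ ψ ⟧ ρ
⟦ φ ∨ᶠ ψ ⟧ ρ = ⟦ φ ⟧ ρ ⊎ ⟦ ψ ⟧ ρ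
⟦ φ ⇒ᶠ ψ ⟧ ρ = ⟦ φ ⟧ ρ → ⟦ ψ ⟧ ρ
⟦ ¬ᶠ φ ⟧ ρ = ¬ ⟦ φ ⟧ ρ
⟦ ∃ᶠ φ ⟧ ρ = Σ ℕ λ a → ⟦ φ ⟧ (a ∷ ρ)
⟦ ∀ᶠ φ ⟧ ρ = (a : ℕ) → ⟦ φ ⟧ (a ∷ ρ)

Definable : (m : ℕ) → (Vector ℕ m → Set) → Set
Definable m P = Σ (Formula m) λ φ → (x : Vector ℕ m) → P x ⇔ ⟦ φ ⟧ x

record Interp (m : ℕ) : Set where
  field
    dom : Formula m
    eqv : Formula (m + m)
    ord : Formula (m + m)

  D : Vector ℕ m → Set
  D x = ⟦ dom ⟧ x

  _∼_ : Vector ℕ m → Vector ℕ m → Set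
  x ∼ y = ⟦ eqv ⟧ (x ++ y)

  _<*_ : Vector ℕ m → Vector ℕ m → Set
  x <* y = ⟦ ord ⟧ (x ++ y)

  Between : Vector ℕ m → Vector ℕ m → Vector ℕ m → Set
  Between a b z = D z × ((a <* z × z <* b) ⊎ (b <* z × z <* a))

  -- Only finitely many points (∼-classes) lie strictly between a and b:
  -- finitely many representatives cover all of them.
  FinitelyBetween : Vector ℕ m → Vector ℕ m → Set
  FinitelyBetween a b =
    Σ (List (Vector ℕ m)) λ l → (z : Vector ℕ m) → Between a b z → Any (z ∼_) l

  Galaxy : Vector ℕ m → Vector ℕ m → Set
  Galaxy a b = D b × FinitelyBetween a b

  GalaxyIso : (A : Set) → (A → A → Set) → Vector ℕ m → Set
  GalaxyIso A _<A_ a =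
    Σ (A → Vector ℕ m) λ f →
      ((i : A) → Galaxy a (f i)) ×
      ((i j : A) → (i <A j) ⇔ (f i <* f j)) ×
      ((b : Vector ℕ m) → Galaxy a b → Σ A λ i → b ∼ f i)

  GalaxyCard : ℕ → Vector ℕ m → Set
  GalaxyCard n a =
    Σ (Fin n → Vector ℕ m) λ f →
      ((i : Fin n) → Galaxy a (f i)) ×
      ((i j : Fin n) → f i ∼ f j → i ≡ j) ×
      ((b : Vector ℕ m) → Galaxy a b → Σ (Fin n) λ i → b ∼ f i)

  Zpred : Vector ℕ m → Set
  Zpred x = D x × GalaxyIso ℤ ℤ._<_ x

  Npred : Vector ℕ m → Set
  Npred x = D x × GalaxyIso ℕ ℕ._<_ x

  N̄pred : Vector ℕ m → Set
  N̄pred x = D x × GalaxyIso ℕ (λ i j → j ℕ.< i) x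

  Fpred : ℕ → Vector ℕ m → Set
  Fpred n x = D x × GalaxyCard n x

record IsLinearInterp {m : ℕ} (I : Interp m) : Set where
  open Interp I
  field
    ∼-refl  : ∀ {x} → D x → x ∼ x
    ∼-sym   : ∀ {x y} → D x → D y → x ∼ y → y ∼ x
    ∼-trans : ∀ {x y z} → D x → D y → D z → x ∼ y → y ∼ z → x ∼ z
    <-resp  : ∀ {x x′ y y′} → D x → D x′ → D y → D y′ →
              x ∼ x′ → y ∼ y′ → x <* y → x′ <* y′
    <-irrefl : ∀ {x} → D x → ¬ (x <* x)
    <-trans : ∀ {x y z} → D x → D y → D z → x <* y → y <* z → x <* z
    <-total : ∀ {x y} → D x → D y → (x <* y) ⊎ (x ∼ y) ⊎ (y <* x)

-- Membership in a galaxy is first-order in (ℕ, +): a set of vectors in ℕ^m is finite iff its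
-- entries are bounded, so "finitely many classes lie strictly between x and y" becomes "some c
-- bounds representatives of all classes strictly between x and y". The order type of a galaxy
-- is then captured by first-order conditions on that definable set: it is ℕ iff it has a least
-- element, every element has an immediate successor and every initial interval is finite; it is
-- ℤ iff every element has an immediate successor and an immediate predecessor and the intervals
-- from x are finite; it has n elements iff n representatives, one block of n·m variables,
-- enumerate it up to the interpreted equality. Conversely, the chain of immediate successors
-- enumerates the galaxy, since by pigeonhole it exhausts every finite interval.

module Submission where

open import Defs
open import Data.Nat using (ℕ; _≥_)
open import Data.Product using (_×_)

open import Data.Nat using (zero; suc; _+_; _*_; _≤_; _<_; z≤n; s≤s; s≤s⁻¹; _⊔_)
import Data.Nat.Properties as ℕ
open import Data.Integer using (ℤ; +_; -[1+_]; ∣_∣)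
import Data.Integer as ℤ
import Data.Integer.Properties as ℤ
open import Data.Fin using (Fin; zero; suc; toℕ; splitAt; combine; _↑ˡ_; _↑ʳ_)
import Data.Fin as Fin
import Data.Fin.Properties as Fin
open import Data.Vec.Functional using (Vector; _∷_; _++_; tail; concat)
open import Data.Vec.Functional.Properties using (∷-cong; ++-cong; lookup-++ˡ; lookup-++ʳ)
open import Data.List using (List; []; length; lookup; upTo)
import Data.List as List
open import Data.List.Membership.Propositional using (_∈_)
open import Data.List.Membership.Propositional.Properties using (∈-upTo⁺)
open import Data.List.Relation.Unary.Any using (Any; here; there; index)
import Data.List.Relation.Unary.Any as Any
import Data.List.Relation.Unary.Any.Properties as Any
open import Data.Product using (Σ; _,_; proj₁; proj₂)
open import Data.Product.Function.NonDependent.Propositional using (_×-⇔_)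
open import Data.Sum using (_⊎_; inj₁; inj₂; [_,_])
open import Data.Sum.Function.Propositional using (_⊎-⇔_)
open import Data.Empty using (⊥; ⊥-elim)
open import Relation.Nullary using (¬_; Dec; yes; no)
open import Relation.Binary.Definitions using (Trichotomous; tri<; tri≈; tri>)
open import Relation.Binary.PropositionalEquality
  using (_≡_; refl; sym; trans; cong; cong₂; subst; subst₂; _≗_)
open import Function using (_∘_; id; flip)
open import Function.Bundles using (_⇔_; mk⇔; Equivalence)
open import Function.Construct.Composition using (_⇔-∘_)
open import Function.Construct.Identity using (⇔-id)
open import Function.Construct.Symmetry using (⇔-sym)
open import Function.Related.TypeIsomorphisms using (→-cong-⇔; ¬-cong-⇔)
open Equivalence using (to; from)

Σ-cong-⇔ : {A : Set} {P Q : A → Set} → (∀ a → P a ⇔ Q a) → Σ A P ⇔ Σ A Q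
Σ-cong-⇔ P⇔Q = mk⇔ (λ (a , p) → a , to (P⇔Q a) p) (λ (a , q) → a , from (P⇔Q a) q)

Π-cong-⇔ : {A : Set} {P Q : A → Set} → (∀ a → P a ⇔ Q a) → ((a : A) → P a) ⇔ ((a : A) → Q a)
Π-cong-⇔ P⇔Q = mk⇔ (λ f a → to (P⇔Q a) (f a)) (λ g a → from (P⇔Q a) (g a))

renameᵗ : ∀ {k n} → (Fin k → Fin n) → Term k → Term n
renameᵗ r (var i) = var (r i)
renameᵗ r (s ⊕ t) = renameᵗ r s ⊕ renameᵗ r t

rename : ∀ {k n} → (Fin k → Fin n) → Formula k → Formula n
rename r (s ≐ t) = renameᵗ r s ≐ renameᵗ r t
rename r ⊥ᶠ = ⊥ᶠ
rename r (φ ∧ᶠ ψ) = rename r φ ∧ᶠ rename r ψ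
rename r (φ ∨ᶠ ψ) = rename r φ ∨ᶠ rename r ψ
rename r (φ ⇒ᶠ ψ) = rename r φ ⇒ᶠ rename r ψ
rename r (¬ᶠ φ) = ¬ᶠ rename r φ
rename r (∃ᶠ φ) = ∃ᶠ (rename (Fin.lift 1 r) φ)
rename r (∀ᶠ φ) = ∀ᶠ (rename (Fin.lift 1 r) φ)

evalT-rename : ∀ {k n} (t : Term k) {r : Fin k → Fin n} {ρ : Vector ℕ n} {σ : Vector ℕ k} →
  ρ ∘ r ≗ σ → evalT (renameᵗ r t) ρ ≡ evalT t σ
evalT-rename (var i) ρr≗σ = ρr≗σ i
evalT-rename (s ⊕ t) ρr≗σ = cong₂ _+_ (evalT-rename s ρr≗σ) (evalT-rename t ρr≗σ)

∷-lift : ∀ {k n} {r : Fin k → Fin n} {ρ : Vector ℕ n} {σ : Vector ℕ k} →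
  ρ ∘ r ≗ σ → ∀ a → (a ∷ ρ) ∘ Fin.lift 1 r ≗ (a ∷ σ)
∷-lift ρr≗σ a zero = refl
∷-lift ρr≗σ a (suc i) = ρr≗σ i

rename-sound : ∀ {k n} (φ : Formula k) {r : Fin k → Fin n} {ρ : Vector ℕ n} {σ : Vector ℕ k} →
  ρ ∘ r ≗ σ → ⟦ rename r φ ⟧ ρ ⇔ ⟦ φ ⟧ σ
rename-sound (s ≐ t) h = mk⇔ (subst₂ _≡_ (evalT-rename s h) (evalT-rename t h))
                             (subst₂ _≡_ (sym (evalT-rename s h)) (sym (evalT-rename t h)))
rename-sound ⊥ᶠ h = ⇔-id ⊥
rename-sound (φ ∧ᶠ ψ) h = rename-sound φ h ×-⇔ rename-sound ψ h
rename-sound (φ ∨ᶠ ψ) h = rename-sound φ h ⊎-⇔ rename-sound ψ h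
rename-sound (φ ⇒ᶠ ψ) h = →-cong-⇔ (rename-sound φ h) (rename-sound ψ h)
rename-sound (¬ᶠ φ) h = ¬-cong-⇔ (rename-sound φ h)
rename-sound (∃ᶠ φ) h = Σ-cong-⇔ λ a → rename-sound φ (∷-lift h a)
rename-sound (∀ᶠ φ) h = Π-cong-⇔ λ a → rename-sound φ (∷-lift h a)

⟦⟧-resp-≗ : ∀ {n} (φ : Formula n) {ρ σ : Vector ℕ n} → ρ ≗ σ → ⟦ φ ⟧ ρ → ⟦ φ ⟧ σ
⟦⟧-resp-≗ φ ρ≗σ = to (rename-sound φ {r = id} ρ≗σ) ∘ from (rename-sound φ {r = id} λ _ → refl)

∃ⁿ : ∀ k {n} → Formula (k + n) → Formula n
∃ⁿ zero φ = φ
∃ⁿ (suc k) φ = ∃ⁿ k (∃ᶠ φ)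

∀ⁿ : ∀ k {n} → Formula (k + n) → Formula n
∀ⁿ zero φ = φ
∀ⁿ (suc k) φ = ∀ⁿ k (∀ᶠ φ)

head∷tail++ : ∀ {k n} (w : Vector ℕ (suc k)) (ρ : Vector ℕ n) → w zero ∷ (tail w ++ ρ) ≗ w ++ ρ
head∷tail++ {k} w ρ zero = refl
head∷tail++ {k} w ρ (suc i) with splitAt k i
... | inj₁ j = refl
... | inj₂ j = refl

∃ⁿ-sound : ∀ k {n} (φ : Formula (k + n)) (ρ : Vector ℕ n) →
  ⟦ ∃ⁿ k φ ⟧ ρ ⇔ Σ (Vector ℕ k) λ w → ⟦ φ ⟧ (w ++ ρ)
∃ⁿ-sound zero φ ρ = mk⇔ ((λ ()) ,_) proj₂
∃ⁿ-sound (suc k) φ ρ = uncons ⇔-∘ ∃ⁿ-sound k (∃ᶠ φ) ρ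
  where
  uncons : (Σ (Vector ℕ k) λ w → Σ ℕ λ a → ⟦ φ ⟧ (a ∷ (w ++ ρ))) ⇔
           (Σ (Vector ℕ (suc k)) λ w → ⟦ φ ⟧ (w ++ ρ))
  uncons = mk⇔ (λ (w , a , p) → a ∷ w , ⟦⟧-resp-≗ φ (head∷tail++ (a ∷ w) ρ) p)
               (λ (w , p) → tail w , w zero , ⟦⟧-resp-≗ φ (sym ∘ head∷tail++ w ρ) p)

∀ⁿ-sound : ∀ k {n} (φ : Formula (k + n)) (ρ : Vector ℕ n) →
  ⟦ ∀ⁿ k φ ⟧ ρ ⇔ ((w : Vector ℕ k) → ⟦ φ ⟧ (w ++ ρ))
∀ⁿ-sound zero φ ρ = mk⇔ (λ p _ → p) (λ f → f (λ ()))
∀ⁿ-sound (suc k) φ ρ = uncons ⇔-∘ ∀ⁿ-sound k (∀ᶠ φ) ρ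
  where
  uncons : ((w : Vector ℕ k) (a : ℕ) → ⟦ φ ⟧ (a ∷ (w ++ ρ))) ⇔
           ((w : Vector ℕ (suc k)) → ⟦ φ ⟧ (w ++ ρ))
  uncons = mk⇔ (λ f w → ⟦⟧-resp-≗ φ (head∷tail++ w ρ) (f (tail w) (w zero)))
               (λ f w a → ⟦⟧-resp-≗ φ (sym ∘ head∷tail++ (a ∷ w) ρ) (f (a ∷ w)))

⋀ᶠ : ∀ {a n} → (Fin a → Formula n) → Formula n
⋀ᶠ {zero} φ = ¬ᶠ ⊥ᶠ
⋀ᶠ {suc a} φ = φ zero ∧ᶠ ⋀ᶠ (φ ∘ suc)

⋁ᶠ : ∀ {a n} → (Fin a → Formula n) → Formula n
⋁ᶠ {zero} φ = ⊥ᶠ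
⋁ᶠ {suc a} φ = φ zero ∨ᶠ ⋁ᶠ (φ ∘ suc)

⋀ᶠ-sound : ∀ {a n} (φ : Fin a → Formula n) ρ → ⟦ ⋀ᶠ φ ⟧ ρ ⇔ (∀ i → ⟦ φ i ⟧ ρ)
⋀ᶠ-sound {zero} φ ρ = mk⇔ (λ _ ()) (λ _ ())
⋀ᶠ-sound {suc a} φ ρ = Fin.∀-cons-⇔ ⇔-∘ (⇔-id _ ×-⇔ ⋀ᶠ-sound (φ ∘ suc) ρ)

⋁ᶠ-sound : ∀ {a n} (φ : Fin a → Formula n) ρ → ⟦ ⋁ᶠ φ ⟧ ρ ⇔ (Σ (Fin a) λ i → ⟦ φ i ⟧ ρ)
⋁ᶠ-sound {zero} φ ρ = mk⇔ (λ ()) (λ ())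
⋁ᶠ-sound {suc a} φ ρ = Fin.⊎⇔∃ ⇔-∘ (⇔-id _ ⊎-⇔ ⋁ᶠ-sound (φ ∘ suc) ρ)

≤ᶠ : Formula 2
≤ᶠ = ∃ᶠ (var (suc (suc zero)) ≐ (var (suc zero) ⊕ var zero))

≤ᶠ-sound : (σ : Vector ℕ 2) → ⟦ ≤ᶠ ⟧ σ ⇔ (σ zero ≤ σ (suc zero))
≤ᶠ-sound σ = mk⇔ (λ (k , eq) → subst (σ zero ≤_) (sym eq) (ℕ.m≤m+n (σ zero) k))
                 (λ le → let (k , eq) = ℕ.m≤n⇒∃[o]m+o≡n le in k , sym eq)

width : List ℕ → ℕ → ℕ
width [] n = n
width (k List.∷ Γ) n = k + width Γ n

data Env : List ℕ → ℕ → Set where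
  free : ∀ {n} → Vector ℕ n → Env [] n
  _∷ₑ_ : ∀ {k Γ n} → Vector ℕ k → Env Γ n → Env (k List.∷ Γ) n

flatten : ∀ {Γ n} → Env Γ n → Vector ℕ (width Γ n)
flatten (free x) = x
flatten (w ∷ₑ e) = w ++ flatten e

-- The field value is determined by position; it is kept so that the semantics of a vector
-- formula unfolds definitionally to the predicate it is written for.
record Tuple (Γ : List ℕ) (n k : ℕ) : Set where
  field
    position : Fin k → Fin (width Γ n)
    value : Env Γ n → Vector ℕ k
    flatten-position : ∀ e → flatten e ∘ position ≗ value e
open Tuple

freeVars : ∀ {n} → Tuple [] n n
position freeVars i = i
value freeVars (free x) = x
flatten-position freeVars (free x) i = refl

newest : ∀ {k Γ n} → Tuple (k List.∷ Γ) n k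
position (newest {Γ = Γ} {n}) i = i ↑ˡ width Γ n
value newest (w ∷ₑ e) = w
flatten-position newest (w ∷ₑ e) = lookup-++ˡ w (flatten e)

weaken : ∀ {j Γ n k} → Tuple Γ n k → Tuple (j List.∷ Γ) n k
position (weaken {j} s) i = j ↑ʳ position s i
value (weaken s) (w ∷ₑ e) = value s e
flatten-position (weaken s) (w ∷ₑ e) i =
  trans (lookup-++ʳ w (flatten e) (position s i)) (flatten-position s e i)

_⧺_ : ∀ {Γ n k l} → Tuple Γ n k → Tuple Γ n l → Tuple Γ n (k + l)
position (_⧺_ {k = k} s t) i = [ position s , position t ] (splitAt k i)
value (s ⧺ t) e = value s e ++ value t e
flatten-position (_⧺_ {k = k} s t) e i with splitAt k i
... | inj₁ j = flatten-position s e j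
... | inj₂ j = flatten-position t e j

coord : ∀ {Γ n k} → Tuple Γ n k → Fin k → Tuple Γ n 1
position (coord s i) _ = position s i
value (coord s i) e _ = value s e i
flatten-position (coord s i) e _ = flatten-position s e i

block : ∀ {Γ n a k} → Tuple Γ n (a * k) → Fin a → Tuple Γ n k
position (block s i) j = position s (combine i j)
value (block s i) e j = value s e (combine i j)
flatten-position (block s i) e j = flatten-position s e (combine i j)

infixr 6 _∧ᵛ_
infixr 5 _∨ᵛ_
infixr 4 _⇒ᵛ_

-- Variables: n free ones, and blocks of the lengths listed in Γ (innermost first) bound above them.
data VFormula (Γ : List ℕ) (n : ℕ) : Set where
  atom : ∀ {k} → Formula k → Tuple Γ n k → VFormula Γ n
  _≤ᵛ_ : Tuple Γ n 1 → Tuple Γ n 1 → VFormula Γ n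
  ⊥ᵛ ⊤ᵛ : VFormula Γ n
  _∧ᵛ_ _∨ᵛ_ _⇒ᵛ_ : VFormula Γ n → VFormula Γ n → VFormula Γ n
  ¬ᵛ_ : VFormula Γ n → VFormula Γ n
  ∃ᵛ ∀ᵛ : (k : ℕ) → VFormula (k List.∷ Γ) n → VFormula Γ n
  ⋀ ⋁ : ∀ {a} → (Fin a → VFormula Γ n) → VFormula Γ n

⟦_⟧ᵛ : ∀ {Γ n} → VFormula Γ n → Env Γ n → Set
⟦ atom φ s ⟧ᵛ e = ⟦ φ ⟧ (value s e)
⟦ s ≤ᵛ t ⟧ᵛ e = value s e zero ≤ value t e zero
⟦ ⊥ᵛ ⟧ᵛ e = ⊥
⟦ ⊤ᵛ ⟧ᵛ e = ¬ ⊥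
⟦ φ ∧ᵛ ψ ⟧ᵛ e = ⟦ φ ⟧ᵛ e × ⟦ ψ ⟧ᵛ e
⟦ φ ∨ᵛ ψ ⟧ᵛ e = ⟦ φ ⟧ᵛ e ⊎ ⟦ ψ ⟧ᵛ e
⟦ φ ⇒ᵛ ψ ⟧ᵛ e = ⟦ φ ⟧ᵛ e → ⟦ ψ ⟧ᵛ e
⟦ ¬ᵛ φ ⟧ᵛ e = ¬ ⟦ φ ⟧ᵛ e
⟦ ∃ᵛ k φ ⟧ᵛ e = Σ (Vector ℕ k) λ w → ⟦ φ ⟧ᵛ (w ∷ₑ e)
⟦ ∀ᵛ k φ ⟧ᵛ e = (w : Vector ℕ k) → ⟦ φ ⟧ᵛ (w ∷ₑ e)
⟦ ⋀ φ ⟧ᵛ e = ∀ i → ⟦ φ i ⟧ᵛ e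
⟦ ⋁ φ ⟧ᵛ e = Σ (Fin _) λ i → ⟦ φ i ⟧ᵛ e

compile : ∀ {Γ n} → VFormula Γ n → Formula (width Γ n)
compile (atom φ s) = rename (position s) φ
compile (s ≤ᵛ t) = rename (position (s ⧺ t)) ≤ᶠ
compile ⊥ᵛ = ⊥ᶠ
compile ⊤ᵛ = ¬ᶠ ⊥ᶠ
compile (φ ∧ᵛ ψ) = compile φ ∧ᶠ compile ψ
compile (φ ∨ᵛ ψ) = compile φ ∨ᶠ compile ψ
compile (φ ⇒ᵛ ψ) = compile φ ⇒ᶠ compile ψ
compile (¬ᵛ φ) = ¬ᶠ compile φ
compile (∃ᵛ k φ) = ∃ⁿ k (compile φ)
compile (∀ᵛ k φ) = ∀ⁿ k (compile φ)
compile (⋀ φ) = ⋀ᶠ (compile ∘ φ)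
compile (⋁ φ) = ⋁ᶠ (compile ∘ φ)

compile-sound : ∀ {Γ n} (φ : VFormula Γ n) (e : Env Γ n) → ⟦ compile φ ⟧ (flatten e) ⇔ ⟦ φ ⟧ᵛ e
compile-sound (atom φ s) e = rename-sound φ (flatten-position s e)
compile-sound (s ≤ᵛ t) e =
  ≤ᶠ-sound (value (s ⧺ t) e) ⇔-∘ rename-sound ≤ᶠ {ρ = flatten e} (flatten-position (s ⧺ t) e)
compile-sound ⊥ᵛ e = ⇔-id ⊥
compile-sound ⊤ᵛ e = ⇔-id (¬ ⊥)
compile-sound (φ ∧ᵛ ψ) e = compile-sound φ e ×-⇔ compile-sound ψ e
compile-sound (φ ∨ᵛ ψ) e = compile-sound φ e ⊎-⇔ compile-sound ψ e
compile-sound (φ ⇒ᵛ ψ) e = →-cong-⇔ (compile-sound φ e) (compile-sound ψ e)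
compile-sound (¬ᵛ φ) e = ¬-cong-⇔ (compile-sound φ e)
compile-sound (∃ᵛ k φ) e =
  Σ-cong-⇔ (λ w → compile-sound φ (w ∷ₑ e)) ⇔-∘ ∃ⁿ-sound k (compile φ) (flatten e)
compile-sound (∀ᵛ k φ) e =
  Π-cong-⇔ (λ w → compile-sound φ (w ∷ₑ e)) ⇔-∘ ∀ⁿ-sound k (compile φ) (flatten e)
compile-sound (⋀ φ) e =
  Π-cong-⇔ (λ i → compile-sound (φ i) e) ⇔-∘ ⋀ᶠ-sound (compile ∘ φ) (flatten e)
compile-sound (⋁ φ) e =
  Σ-cong-⇔ (λ i → compile-sound (φ i) e) ⇔-∘ ⋁ᶠ-sound (compile ∘ φ) (flatten e)

definable-by : ∀ {m} {P : Vector ℕ m → Set} (φ : VFormula [] m) →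
  (∀ x → P x ⇔ ⟦ φ ⟧ᵛ (free x)) → Definable m P
definable-by φ P⇔φ = compile φ , λ x → ⇔-sym (compile-sound φ (free x)) ⇔-∘ P⇔φ x

⌊_⌋ᵛ : ∀ {Γ n} {P : Set} → Dec P → VFormula Γ n
⌊ yes _ ⌋ᵛ = ⊤ᵛ
⌊ no _ ⌋ᵛ = ⊥ᵛ

⌊⌋ᵛ-sound : ∀ {Γ n} {P : Set} (P? : Dec P) (e : Env Γ n) → ⟦ ⌊ P? ⌋ᵛ ⟧ᵛ e ⇔ P
⌊⌋ᵛ-sound (yes p) e = mk⇔ (λ _ → p) (λ _ ())
⌊⌋ᵛ-sound (no ¬p) e = mk⇔ ⊥-elim ¬p

Bounded : ∀ {k} → ℕ → Vector ℕ k → Set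
Bounded c w = ∀ i → w i ≤ c

box : (k c : ℕ) → List (Vector ℕ k)
box zero c = List.[ (λ ()) ]
box (suc k) c = List.cartesianProductWith _∷_ (upTo (suc c)) (box k c)

box-complete : ∀ {k c} (w : Vector ℕ k) → Bounded c w → Any (w ≗_) (box k c)
box-complete {zero} w _ = here (λ ())
box-complete {suc k} w w≤c =
  Any.cartesianProductWith⁺ _∷_ ∷-cong (∈-upTo⁺ (s≤s (w≤c zero)))
                                       (box-complete (tail w) (w≤c ∘ suc))

maxEntry : ∀ {k} → Vector ℕ k → ℕ
maxEntry {zero} w = 0
maxEntry {suc k} w = w zero ⊔ maxEntry (tail w)

Bounded-maxEntry : ∀ {k} (w : Vector ℕ k) → Bounded (maxEntry w) w
Bounded-maxEntry w zero = ℕ.m≤m⊔n _ _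
Bounded-maxEntry w (suc i) = ℕ.≤-trans (Bounded-maxEntry (tail w) i) (ℕ.m≤n⊔m (w zero) _)

maxEntries : ∀ {k} → List (Vector ℕ k) → ℕ
maxEntries [] = 0
maxEntries (u List.∷ l) = maxEntry u ⊔ maxEntries l

Any-Bounded : ∀ {k} {P : Vector ℕ k → Set} {l} →
  Any P l → Σ (Vector ℕ k) λ u → P u × Bounded (maxEntries l) u
Any-Bounded {l = u List.∷ l} (here p) = u , p , λ i → ℕ.≤-trans (Bounded-maxEntry u i) (ℕ.m≤m⊔n _ _)
Any-Bounded {l = u List.∷ l} (there q) =
  let (v , p , v≤) = Any-Bounded q in v , p , λ i → ℕ.≤-trans (v≤ i) (ℕ.m≤n⊔m (maxEntry u) _)

module _ {k} (R : Vector ℕ k → Vector ℕ k → Set) where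

  FiniteCover : (Vector ℕ k → Set) → Set
  FiniteCover S = Σ (List (Vector ℕ k)) λ l → ∀ z → S z → Any (R z) l

  -- A finite set of vectors is one whose entries are bounded; the bound is a one-element vector
  -- so that it is quantified like every other block of variables.
  BoundedCover : (Vector ℕ k → Set) → Set
  BoundedCover S =
    Σ (Vector ℕ 1) λ c → ∀ z → S z → Σ (Vector ℕ k) λ w → Bounded (c zero) w × R z w

  FiniteCover⇒BoundedCover : ∀ {S} → FiniteCover S → BoundedCover S
  FiniteCover⇒BoundedCover (l , cover) = (λ _ → maxEntries l) , λ z s →
    let (u , zRu , u≤) = Any-Bounded (cover z s) in u , u≤ , zRu

  BoundedCover⇒FiniteCover : (∀ {z u w} → u ≗ w → R z u → R z w) →
    ∀ {S} → BoundedCover S → FiniteCover S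
  BoundedCover⇒FiniteCover R-resp (c , cover) = box k (c zero) , λ z s →
    let (w , w≤ , zRw) = cover z s in Any.map (λ w≗u → R-resp w≗u zRw) (box-complete w w≤)

  FiniteCover-mono : ∀ {S S′} → (∀ z → S′ z → S z) → FiniteCover S → FiniteCover S′
  FiniteCover-mono S′⊆S (l , cover) = l , λ z → cover z ∘ S′⊆S z

ImmediateSuccessor : {A : Set} → (A → A → Set) → (A → A) → Set
ImmediateSuccessor _<A_ s = ∀ i → i <A s i × (∀ k → ¬ (i <A k × k <A s i))

FiniteIntervals : {A : Set} → (A → A → Set) → Set
FiniteIntervals {A} _<A_ = ∀ a b → Σ (List A) λ l → ∀ k → a <A k → k <A b → k ∈ l

ℕ-suc-immediate : ImmediateSuccessor _<_ suc
ℕ-suc-immediate i = ℕ.n<1+n i , λ k (i<k , k<1+i) → ℕ.<⇒≱ i<k (s≤s⁻¹ k<1+i)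

ℕ-finiteIntervals : FiniteIntervals _<_
ℕ-finiteIntervals a b = upTo b , λ k _ k<b → ∈-upTo⁺ k<b

ℤ-suc-immediate : ImmediateSuccessor ℤ._<_ ℤ.suc
ℤ-suc-immediate i =
  ℤ.suc[i]≤j⇒i<j ℤ.≤-refl , λ k (i<k , k<1+i) → ℤ.<⇒≱ k<1+i (ℤ.i<j⇒suc[i]≤j i<k)

ℤ-pred-immediate : ImmediateSuccessor (flip ℤ._<_) ℤ.pred
ℤ-pred-immediate i =
  ℤ.suc[i]≤j⇒i<j (ℤ.≤-reflexive (ℤ.suc-pred i)) ,
  λ k (k<i , pred-i<k) → ℤ.<⇒≱ pred-i<k (ℤ.i<j⇒i≤pred[j] k<i)

ℤ-ball : ℕ → List ℤ
ℤ-ball N = List.map (+_) (upTo (suc N)) List.++ List.map -[1+_] (upTo N)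

∈-ℤ-ball : ∀ {N} k → ∣ k ∣ ≤ N → k ∈ ℤ-ball N
∈-ℤ-ball (+ t) t≤N = Any.++⁺ˡ (Any.map⁺ (Any.map (cong (+_)) (∈-upTo⁺ (s≤s t≤N))))
∈-ℤ-ball -[1+ t ] 1+t≤N = Any.++⁺ʳ _ (Any.map⁺ (Any.map (cong -[1+_]) (∈-upTo⁺ 1+t≤N)))

∣∣-between : ∀ {a k b} → a ℤ.< k → k ℤ.< b → ∣ k ∣ ≤ ∣ a ∣ ⊔ ∣ b ∣
∣∣-between {a} {+ t} {+ u} _ (ℤ.+<+ t<u) = ℕ.≤-trans (ℕ.<⇒≤ t<u) (ℕ.m≤n⊔m ∣ a ∣ u)
∣∣-between { -[1+ s ]} { -[1+ t ]} {b} (ℤ.-<- t<s) _ =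
  ℕ.≤-trans (s≤s (ℕ.<⇒≤ t<s)) (ℕ.m≤m⊔n (suc s) ∣ b ∣)

ℤ-finiteIntervals : FiniteIntervals ℤ._<_
ℤ-finiteIntervals a b = ℤ-ball (∣ a ∣ ⊔ ∣ b ∣) , λ k a<k k<b → ∈-ℤ-ball k (∣∣-between a<k k<b)

module Galaxies {m} (I : Interp m) (I-linear : IsLinearInterp I) where
  open Interp I
  open IsLinearInterp I-linear

  V : Set
  V = Vector ℕ m

  D-resp-≗ : ∀ {a a′ : V} → a ≗ a′ → D a → D a′
  D-resp-≗ = ⟦⟧-resp-≗ (Interp.dom I)

  ∼-resp-≗ : ∀ {a a′ b b′ : V} → a ≗ a′ → b ≗ b′ → a ∼ b → a′ ∼ b′
  ∼-resp-≗ {a} {a′} a≗a′ b≗b′ = ⟦⟧-resp-≗ (Interp.eqv I) (++-cong a a′ a≗a′ b≗b′)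

  <*-resp-≗ : ∀ {a a′ b b′ : V} → a ≗ a′ → b ≗ b′ → a <* b → a′ <* b′
  <*-resp-≗ {a} {a′} a≗a′ b≗b′ = ⟦⟧-resp-≗ (Interp.ord I) (++-cong a a′ a≗a′ b≗b′)

  Representative : V → V → Set
  Representative z u = D u × z ∼ u

  Representative-resp-≗ : ∀ {z u w} → u ≗ w → Representative z u → Representative z w
  Representative-resp-≗ u≗w (Du , z∼u) = D-resp-≗ u≗w Du , ∼-resp-≗ (λ _ → refl) u≗w z∼u

  Galaxyᵇ : V → V → Set
  Galaxyᵇ x y = D y × BoundedCover _∼_ (Between x y)

  Galaxy⇔Galaxyᵇ : ∀ {x y} → Galaxy x y ⇔ Galaxyᵇ x y
  Galaxy⇔Galaxyᵇ = ⇔-id _ ×-⇔ mk⇔ (FiniteCover⇒BoundedCover _∼_)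
    (BoundedCover⇒FiniteCover _∼_ (∼-resp-≗ (λ _ → refl)))

  Between-irrefl : ∀ {x z} → D x → ¬ Between x x z
  Between-irrefl Dx (Dz , inj₁ (x<z , z<x)) = <-irrefl Dx (<-trans Dx Dz Dx x<z z<x)
  Between-irrefl Dx (Dz , inj₂ (x<z , z<x)) = <-irrefl Dx (<-trans Dx Dz Dx x<z z<x)

  Galaxyᵇ-refl : ∀ {x} → D x → Galaxyᵇ x x
  Galaxyᵇ-refl Dx = Dx , (λ _ → 0) , λ z x<z<x → ⊥-elim (Between-irrefl Dx x<z<x)

  Galaxyᵇ-resp-≗ : ∀ {x y y′} → y ≗ y′ → Galaxyᵇ x y → Galaxyᵇ x y′
  Galaxyᵇ-resp-≗ {x} {y} {y′} y≗y′ (Dy , c , cover) =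
    D-resp-≗ y≗y′ Dy , c , λ z → cover z ∘ between
    where
    y′≗y : y′ ≗ y
    y′≗y = sym ∘ y≗y′
    between : ∀ {z} → Between x y′ z → Between x y z
    between (Dz , inj₁ (x<z , z<y′)) = Dz , inj₁ (x<z , <*-resp-≗ (λ _ → refl) y′≗y z<y′)
    between (Dz , inj₂ (y′<z , z<x)) = Dz , inj₂ (<*-resp-≗ y′≗y (λ _ → refl) y′<z , z<x)

  cover-pigeonhole : (l : List V) (g : Fin (suc (length l)) → V) → (∀ i → D (g i)) →
    (∀ i → Any (Representative (g i)) l) → (∀ i j → g i ∼ g j → i ≡ j) → ⊥
  cover-pigeonhole l g Dg cover g-injective
    with Fin.pigeonhole (ℕ.n<1+n (length l)) (index ∘ cover)
  ... | i , j , i<j , same-index =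
    let (Du , gi∼u) = Any.lookup-index (cover i)
        (_ , gj∼u) = subst (λ k → Representative (g j) (lookup l k)) (sym same-index)
                           (Any.lookup-index (cover j))
        gi∼gj = ∼-trans (Dg i) Du (Dg j) gi∼u (∼-sym (Dg j) Du gj∼u)
    in ℕ.<-irrefl (cong toℕ (g-injective i j gi∼gj)) i<j

  record IsStrictLinear (_≺_ : V → V → Set) : Set where
    field
      ≺-irrefl : ∀ {x} → D x → ¬ (x ≺ x)
      ≺-trans : ∀ {x y z} → D x → D y → D z → x ≺ y → y ≺ z → x ≺ z
      ≺-resp : ∀ {x x′ y y′} → D x → D x′ → D y → D y′ → x ∼ x′ → y ∼ y′ → x ≺ y → x′ ≺ y′
      ≺-total : ∀ {x y} → D x → D y → (x ≺ y) ⊎ (x ∼ y) ⊎ (y ≺ x)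

  <*-strictLinear : IsStrictLinear _<*_
  <*-strictLinear = record
    { ≺-irrefl = <-irrefl ; ≺-trans = <-trans ; ≺-resp = <-resp ; ≺-total = <-total }

  >*-strictLinear : IsStrictLinear (flip _<*_)
  >*-strictLinear = record
    { ≺-irrefl = <-irrefl
    ; ≺-trans = λ Dx Dy Dz y<x z<y → <-trans Dz Dy Dx z<y y<x
    ; ≺-resp = λ Dx Dx′ Dy Dy′ x∼x′ y∼y′ → <-resp Dy Dy′ Dx Dx′ y∼y′ x∼x′
    ; ≺-total = λ Dx Dy → reverse (<-total Dx Dy)
    }
    where
    reverse : ∀ {x y} → (x <* y) ⊎ (x ∼ y) ⊎ (y <* x) → (y <* x) ⊎ (x ∼ y) ⊎ (x <* y)
    reverse (inj₁ x<y) = inj₂ (inj₂ x<y)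
    reverse (inj₂ (inj₁ x∼y)) = inj₂ (inj₁ x∼y)
    reverse (inj₂ (inj₂ y<x)) = inj₁ y<x

  OrderIso : (V → V → Set) → (V → Set) → (A : Set) → (A → A → Set) → Set
  OrderIso _≺_ G A _<A_ = Σ (A → V) λ f →
    ((i : A) → G (f i)) ×
    ((i j : A) → (i <A j) ⇔ (f i ≺ f j)) ×
    ((b : V) → G b → Σ A λ i → b ∼ f i)

  OrderIso-flip : ∀ {_≺_ G A _<A_} → OrderIso _≺_ G A _<A_ → OrderIso (flip _≺_) G A (flip _<A_)
  OrderIso-flip (f , f∈G , f-iso , cover) = f , f∈G , flip f-iso , cover

  OrderIso-cong : ∀ {_≺_ G G′ A _<A_} → (∀ {y} → G y ⇔ G′ y) →
    OrderIso _≺_ G A _<A_ ⇔ OrderIso _≺_ G′ A _<A_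
  OrderIso-cong G⇔G′ = mk⇔
    (λ (f , f∈G , f-iso , cover) → f , to G⇔G′ ∘ f∈G , f-iso , λ b → cover b ∘ from G⇔G′)
    (λ (f , f∈G′ , f-iso , cover) → f , from G⇔G′ ∘ f∈G′ , f-iso , λ b → cover b ∘ to G⇔G′)

  module Suborder {_≺_ : V → V → Set} (≺-linear : IsStrictLinear _≺_)
                  (G : V → Set) (G⊆D : ∀ {y} → G y → D y) where
    open IsStrictLinear ≺-linear

    monotone⇒embedding : ∀ {A : Set} {_<A_ : A → A → Set} → Trichotomous _≡_ _<A_ →
      (f : A → V) → (∀ i → D (f i)) → (∀ {i j} → i <A j → f i ≺ f j) →
      ∀ i j → (i <A j) ⇔ (f i ≺ f j)
    monotone⇒embedding {_<A_ = _<A_} compare f Df f-mono i j = mk⇔ f-mono reflect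
      where
      reflect : f i ≺ f j → i <A j
      reflect fi≺fj with compare i j
      ... | tri< i<j _ _ = i<j
      ... | tri≈ _ refl _ = ⊥-elim (≺-irrefl (Df i) fi≺fj)
      ... | tri> _ _ j<i = ⊥-elim (≺-irrefl (Df i) (≺-trans (Df i) (Df j) (Df i) fi≺fj (f-mono j<i)))

    HasImmediateSuccessors : Set
    HasImmediateSuccessors =
      ∀ y → G y → Σ V λ s → G s × y ≺ s × (∀ z → G z → ¬ (y ≺ z × z ≺ s))

    BoundedIntervals : V → Set
    BoundedIntervals e = ∀ y → G y →
      BoundedCover Representative (λ z → G z × ((e ≺ z × z ≺ y) ⊎ (y ≺ z × z ≺ e)))

    module FromOrderIso {A : Set} {_<A_ : A → A → Set} (f : A → V) (f∈G : ∀ i → G (f i))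
      (f-iso : ∀ i j → (i <A j) ⇔ (f i ≺ f j)) (cover : ∀ b → G b → Σ A λ i → b ∼ f i) where

      Df : ∀ i → D (f i)
      Df = G⊆D ∘ f∈G

      reflect : ∀ {y z i j} → G y → G z → y ∼ f i → z ∼ f j → y ≺ z → i <A j
      reflect y∈G z∈G y∼fi z∼fj y≺z =
        from (f-iso _ _) (≺-resp (G⊆D y∈G) (Df _) (G⊆D z∈G) (Df _) y∼fi z∼fj y≺z)

      immediateSuccessors : ∀ {s} → ImmediateSuccessor _<A_ s → HasImmediateSuccessors
      immediateSuccessors {s} s-immediate y y∈G =
        let (i , y∼fi) = cover y y∈G
            (i<si , nothing-between) = s-immediate i
            Dy = G⊆D y∈G
            fsi∼fsi = ∼-refl (Df (s i))
        in f (s i) , f∈G (s i) ,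
           ≺-resp (Df i) Dy (Df (s i)) (Df (s i)) (∼-sym Dy (Df i) y∼fi) fsi∼fsi
                  (to (f-iso i (s i)) i<si) ,
           λ z z∈G (y≺z , z≺fsi) → let (k , z∼fk) = cover z z∈G in
             nothing-between k (reflect y∈G z∈G y∼fi z∼fk y≺z ,
                                reflect z∈G (f∈G (s i)) z∼fk fsi∼fsi z≺fsi)

      boundedIntervals : FiniteIntervals _<A_ → ∀ e → G e → BoundedIntervals e
      boundedIntervals intervals e e∈G y y∈G =
        FiniteCover⇒BoundedCover Representative (List.map f l , covered)
        where
        a j : A
        a = proj₁ (cover e e∈G)
        j = proj₁ (cover y y∈G)
        l : List A
        l = proj₁ (intervals a j) List.++ proj₁ (intervals j a)
        k∈l : ∀ {z k} → G z → z ∼ f k → (e ≺ z × z ≺ y) ⊎ (y ≺ z × z ≺ e) → k ∈ l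
        k∈l {k = k} z∈G z∼fk =
          [ (λ (e≺z , z≺y) → Any.++⁺ˡ (proj₂ (intervals a j) k
               (reflect e∈G z∈G e∼fa z∼fk e≺z) (reflect z∈G y∈G z∼fk y∼fj z≺y)))
          , (λ (y≺z , z≺e) → Any.++⁺ʳ (proj₁ (intervals a j)) (proj₂ (intervals j a) k
               (reflect y∈G z∈G y∼fj z∼fk y≺z) (reflect z∈G e∈G z∼fk e∼fa z≺e))) ]
          where
          e∼fa : e ∼ f a
          e∼fa = proj₂ (cover e e∈G)
          y∼fj : y ∼ f j
          y∼fj = proj₂ (cover y y∈G)
        covered : ∀ z → G z × ((e ≺ z × z ≺ y) ⊎ (y ≺ z × z ≺ e)) →
                  Any (Representative z) (List.map f l)
        covered z (z∈G , between) = let (k , z∼fk) = cover z z∈G in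
          Any.map⁺ (Any.map (λ { refl → Df k , z∼fk }) (k∈l z∈G z∼fk between))

    module Chain (successor : HasImmediateSuccessors) {b : V} (b∈G : G b) where

      next : Σ V G → Σ V G
      next (y , y∈G) = proj₁ (successor y y∈G) , proj₁ (proj₂ (successor y y∈G))

      chain : ℕ → Σ V G
      chain zero = b , b∈G
      chain (suc n) = next (chain n)

      point : ℕ → V
      point = proj₁ ∘ chain

      point∈G : ∀ n → G (point n)
      point∈G = proj₂ ∘ chain

      Dpoint : ∀ n → D (point n)
      Dpoint = G⊆D ∘ point∈G

      point-step : ∀ n → point n ≺ point (suc n)
      point-step n = proj₁ (proj₂ (proj₂ (successor (point n) (point∈G n))))

      point-gap : ∀ n z → G z → ¬ (point n ≺ z × z ≺ point (suc n))
      point-gap n = proj₂ (proj₂ (proj₂ (successor (point n) (point∈G n))))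

      point-mono : ∀ {n k} → n < k → point n ≺ point k
      point-mono {n} {suc k} n<1+k with ℕ.m≤n⇒m<n∨m≡n (s≤s⁻¹ n<1+k)
      ... | inj₁ n<k = ≺-trans (Dpoint n) (Dpoint k) (Dpoint (suc k)) (point-mono n<k) (point-step k)
      ... | inj₂ refl = point-step n

      point-injective : ∀ {n k} → point n ∼ point k → n ≡ k
      point-injective {n} {k} pn∼pk with ℕ.<-cmp n k
      ... | tri< n<k _ _ = ⊥-elim (≺-irrefl (Dpoint k)
              (≺-resp (Dpoint n) (Dpoint k) (Dpoint k) (Dpoint k) pn∼pk (∼-refl (Dpoint k))
                      (point-mono n<k)))
      ... | tri≈ _ n≡k _ = n≡k
      ... | tri> _ _ k<n = ⊥-elim (≺-irrefl (Dpoint n)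
              (≺-resp (Dpoint k) (Dpoint n) (Dpoint n) (Dpoint n) (∼-sym (Dpoint n) (Dpoint k) pn∼pk)
                      (∼-refl (Dpoint n)) (point-mono k<n)))

      point≺ : ∀ {y n k} → D y → point n ≺ y → k ≤ n → point k ≺ y
      point≺ {n = n} {k} Dy pn≺y k≤n with ℕ.m≤n⇒m<n∨m≡n k≤n
      ... | inj₁ k<n = ≺-trans (Dpoint k) (Dpoint n) Dy (point-mono k<n) pn≺y
      ... | inj₂ refl = pn≺y

      hit-or-beyond : ∀ {y} → G y → b ≺ y → ∀ n → (Σ ℕ λ k → y ∼ point k) ⊎ point n ≺ y
      hit-or-beyond y∈G b≺y zero = inj₂ b≺y
      hit-or-beyond {y} y∈G b≺y (suc n) with hit-or-beyond y∈G b≺y n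
      ... | inj₁ hit = inj₁ hit
      ... | inj₂ pn≺y with ≺-total (Dpoint (suc n)) (G⊆D y∈G)
      ...   | inj₁ beyond = inj₂ beyond
      ...   | inj₂ (inj₁ p∼y) = inj₁ (suc n , ∼-sym (Dpoint (suc n)) (G⊆D y∈G) p∼y)
      ...   | inj₂ (inj₂ y≺p) = ⊥-elim (point-gap n y y∈G (pn≺y , y≺p))

      -- If y is never hit, it lies beyond point 1, …, point (length l + 1): too many
      -- pairwise inequivalent points strictly between b and y for the cover l.
      points-exhaust : ∀ {y} → G y → b ≺ y →
        FiniteCover Representative (λ z → G z × b ≺ z × z ≺ y) → Σ ℕ λ k → y ∼ point k
      points-exhaust y∈G b≺y (l , cover) with hit-or-beyond y∈G b≺y (suc (length l))
      ... | inj₁ hit = hit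
      ... | inj₂ beyond = ⊥-elim (cover-pigeonhole l (point ∘ suc ∘ toℕ) (Dpoint ∘ suc ∘ toℕ)
              (λ i → cover _ (point∈G (suc (toℕ i)) , point-mono {0} {suc (toℕ i)} (s≤s z≤n) ,
                              point≺ {n = suc (length l)} (G⊆D y∈G) beyond (Fin.toℕ<n i)))
              (λ i j → Fin.toℕ-injective ∘ ℕ.suc-injective ∘ point-injective))

    ℕLike : Set
    ℕLike = Σ V λ e → G e × (∀ z → G z → ¬ (z ≺ e)) × HasImmediateSuccessors × BoundedIntervals e

    ℕLike⇒OrderIso : ℕLike → OrderIso _≺_ G ℕ _<_
    ℕLike⇒OrderIso (e , e∈G , least , successor , bounded) =
      point , point∈G , monotone⇒embedding ℕ.<-cmp point Dpoint point-mono , cover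
      where
      open Chain successor e∈G
      cover : ∀ y → G y → Σ ℕ λ k → y ∼ point k
      cover y y∈G with ≺-total (G⊆D e∈G) (G⊆D y∈G)
      ... | inj₁ e≺y = points-exhaust y∈G e≺y
              (FiniteCover-mono Representative (λ z (z∈G , e≺z , z≺y) → z∈G , inj₁ (e≺z , z≺y))
                (BoundedCover⇒FiniteCover Representative Representative-resp-≗ (bounded y y∈G)))
      ... | inj₂ (inj₁ e∼y) = 0 , ∼-sym (G⊆D e∈G) (G⊆D y∈G) e∼y
      ... | inj₂ (inj₂ y≺e) = ⊥-elim (least y y∈G y≺e)

    OrderIso⇒ℕLike : OrderIso _≺_ G ℕ _<_ → ℕLike
    OrderIso⇒ℕLike (f , f∈G , f-iso , cover) =
      f 0 , f∈G 0 , least , immediateSuccessors ℕ-suc-immediate ,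
      boundedIntervals ℕ-finiteIntervals (f 0) (f∈G 0)
      where
      open FromOrderIso f f∈G f-iso cover
      least : ∀ z → G z → ¬ (z ≺ f 0)
      least z z∈G z≺f0 = let (k , z∼fk) = cover z z∈G in
        ℕ.n≮0 (reflect z∈G (f∈G 0) z∼fk (∼-refl (Df 0)) z≺f0)

    ℕLike⇔OrderIso : ℕLike ⇔ OrderIso _≺_ G ℕ _<_
    ℕLike⇔OrderIso = mk⇔ ℕLike⇒OrderIso OrderIso⇒ℕLike

  module ℤType (x : V) where

    module Up = Suborder <*-strictLinear (Galaxyᵇ x) proj₁
    module Down = Suborder >*-strictLinear (Galaxyᵇ x) proj₁

    ℤLike : Set
    ℤLike = D x × Up.HasImmediateSuccessors × Down.HasImmediateSuccessors × Up.BoundedIntervals x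

    ℤLike⇒OrderIso : ℤLike → OrderIso _<*_ (Galaxyᵇ x) ℤ ℤ._<_
    ℤLike⇒OrderIso (Dx , up , down , bounded) =
      f , f∈G , Up.monotone⇒embedding ℤ.<-cmp f Df f-mono , cover
      where
      module U = Up.Chain up (Galaxyᵇ-refl Dx)
      module L = Down.Chain down (Galaxyᵇ-refl Dx)
      f : ℤ → V
      f (+ n) = U.point n
      f -[1+ n ] = L.point (suc n)
      f∈G : ∀ i → Galaxyᵇ x (f i)
      f∈G (+ n) = U.point∈G n
      f∈G -[1+ n ] = L.point∈G (suc n)
      Df : ∀ i → D (f i)
      Df = proj₁ ∘ f∈G
      f-mono : ∀ {i j} → i ℤ.< j → f i <* f j
      f-mono (ℤ.+<+ m<n) = U.point-mono m<n
      f-mono { -[1+ k ]} {+ zero} ℤ.-<+ = L.point-mono {0} {suc k} (s≤s z≤n)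
      f-mono { -[1+ k ]} {+ suc n} ℤ.-<+ = <-trans (Df -[1+ k ]) Dx (Df (+ suc n))
        (L.point-mono {0} {suc k} (s≤s z≤n)) (U.point-mono {0} {suc n} (s≤s z≤n))
      f-mono (ℤ.-<- n<m) = L.point-mono (s≤s n<m)
      between-finite : ∀ b → Galaxyᵇ x b →
        FiniteCover Representative (λ z → Galaxyᵇ x z × ((x <* z × z <* b) ⊎ (b <* z × z <* x)))
      between-finite b b∈G =
        BoundedCover⇒FiniteCover Representative Representative-resp-≗ (bounded b b∈G)
      cover : ∀ b → Galaxyᵇ x b → Σ ℤ λ i → b ∼ f i
      cover b b∈G with <-total Dx (proj₁ b∈G)
      ... | inj₁ x<b =
        let (k , b∼) = U.points-exhaust b∈G x<b (FiniteCover-mono Representative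
                         (λ z (z∈G , x<z , z<b) → z∈G , inj₁ (x<z , z<b)) (between-finite b b∈G))
        in + k , b∼
      ... | inj₂ (inj₁ x∼b) = + 0 , ∼-sym Dx (proj₁ b∈G) x∼b
      ... | inj₂ (inj₂ b<x)
        with L.points-exhaust b∈G b<x (FiniteCover-mono Representative
               (λ z (z∈G , z<x , b<z) → z∈G , inj₂ (b<z , z<x)) (between-finite b b∈G))
      ...   | zero , b∼x = + 0 , b∼x
      ...   | suc k , b∼ = -[1+ k ] , b∼

    OrderIso⇒ℤLike : D x → OrderIso _<*_ (Galaxyᵇ x) ℤ ℤ._<_ → ℤLike
    OrderIso⇒ℤLike Dx (f , f∈G , f-iso , cover) =
      Dx , U.immediateSuccessors ℤ-suc-immediate , L.immediateSuccessors ℤ-pred-immediate ,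
      U.boundedIntervals ℤ-finiteIntervals x (Galaxyᵇ-refl Dx)
      where
      module U = Up.FromOrderIso f f∈G f-iso cover
      module L = Down.FromOrderIso f f∈G (flip f-iso) cover

    ℤLike⇔OrderIso : ℤLike ⇔ (D x × OrderIso _<*_ (Galaxyᵇ x) ℤ ℤ._<_)
    ℤLike⇔OrderIso = mk⇔ (λ ℤ-like → proj₁ ℤ-like , ℤLike⇒OrderIso ℤ-like)
                         (λ (Dx , iso) → OrderIso⇒ℤLike Dx iso)

module Formulas {m : ℕ} (I : Interp m) where
  open Interp I using (dom; eqv; ord)

  Point : List ℕ → Set
  Point Γ = Tuple Γ m m

  Dᵛ : ∀ {Γ} → Point Γ → VFormula Γ m
  Dᵛ s = atom dom s

  _∼ᵛ_ _<ᵛ_ _>ᵛ_ : ∀ {Γ} → Point Γ → Point Γ → VFormula Γ m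
  s ∼ᵛ t = atom eqv (s ⧺ t)
  s <ᵛ t = atom ord (s ⧺ t)
  s >ᵛ t = t <ᵛ s

  betweenᵛ : ∀ {Γ} → Point Γ → Point Γ → Point Γ → VFormula Γ m
  betweenᵛ x y z = Dᵛ z ∧ᵛ ((x <ᵛ z ∧ᵛ z <ᵛ y) ∨ᵛ (y <ᵛ z ∧ᵛ z <ᵛ x))

  boundedᵛ : ∀ {Γ} → Tuple Γ m 1 → Point Γ → VFormula Γ m
  boundedᵛ c w = ⋀ λ i → coord w i ≤ᵛ c

  galaxyᵛ : ∀ {Γ} → Point Γ → Point Γ → VFormula Γ m
  galaxyᵛ x y = Dᵛ y ∧ᵛ ∃ᵛ 1 (∀ᵛ m (betweenᵛ (weaken (weaken x)) (weaken (weaken y)) newest ⇒ᵛ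
                  ∃ᵛ m (boundedᵛ (weaken (weaken newest)) newest ∧ᵛ weaken newest ∼ᵛ newest)))

  RelationFormula : Set
  RelationFormula = ∀ {Γ} → Point Γ → Point Γ → VFormula Γ m

  immediateSuccessorsᵛ : RelationFormula → ∀ {Γ} → Point Γ → VFormula Γ m
  immediateSuccessorsᵛ _≺ᵛ_ x =
    ∀ᵛ m (galaxyᵛ (weaken x) newest ⇒ᵛ
      ∃ᵛ m (galaxyᵛ (weaken (weaken x)) newest ∧ᵛ weaken newest ≺ᵛ newest ∧ᵛ
        ∀ᵛ m (galaxyᵛ (weaken (weaken (weaken x))) newest ⇒ᵛ
          ¬ᵛ (weaken (weaken newest) ≺ᵛ newest ∧ᵛ newest ≺ᵛ weaken newest))))

  boundedIntervalsᵛ : RelationFormula → ∀ {Γ} → Point Γ → Point Γ → VFormula Γ m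
  boundedIntervalsᵛ _≺ᵛ_ x e =
    ∀ᵛ m (galaxyᵛ (weaken x) newest ⇒ᵛ ∃ᵛ 1 (∀ᵛ m (
      (galaxyᵛ x′ newest ∧ᵛ ((e′ ≺ᵛ newest ∧ᵛ newest ≺ᵛ y′) ∨ᵛ (y′ ≺ᵛ newest ∧ᵛ newest ≺ᵛ e′))) ⇒ᵛ
      ∃ᵛ m (boundedᵛ (weaken (weaken newest)) newest ∧ᵛ Dᵛ newest ∧ᵛ weaken newest ∼ᵛ newest))))
    where
    x′ e′ : Point _
    x′ = weaken (weaken (weaken x))
    e′ = weaken (weaken (weaken e))
    y′ : Point _
    y′ = weaken (weaken newest)

  ℤLikeᵛ : VFormula [] m
  ℤLikeᵛ = Dᵛ freeVars ∧ᵛ immediateSuccessorsᵛ _<ᵛ_ freeVars ∧ᵛ immediateSuccessorsᵛ _>ᵛ_ freeVars ∧ᵛ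
           boundedIntervalsᵛ _<ᵛ_ freeVars freeVars

  ℕLikeᵛ : RelationFormula → VFormula [] m
  ℕLikeᵛ _≺ᵛ_ = Dᵛ freeVars ∧ᵛ ∃ᵛ m (galaxyᵛ (weaken freeVars) newest ∧ᵛ
    ∀ᵛ m (galaxyᵛ (weaken (weaken freeVars)) newest ⇒ᵛ ¬ᵛ (newest ≺ᵛ weaken newest)) ∧ᵛ
    immediateSuccessorsᵛ _≺ᵛ_ (weaken freeVars) ∧ᵛ boundedIntervalsᵛ _≺ᵛ_ (weaken freeVars) newest)

  -- The n elements of the galaxy are the n blocks of one variable block of length n * m.
  cardinalityᵛ : ℕ → VFormula [] m
  cardinalityᵛ n = Dᵛ freeVars ∧ᵛ ∃ᵛ (n * m) (
    ⋀ (λ i → galaxyᵛ (weaken freeVars) (element i)) ∧ᵛ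
    ⋀ (λ i → ⋀ λ j → element i ∼ᵛ element j ⇒ᵛ ⌊ i Fin.≟ j ⌋ᵛ) ∧ᵛ
    ∀ᵛ m (galaxyᵛ (weaken (weaken freeVars)) newest ⇒ᵛ ⋁ λ i → newest ∼ᵛ weaken (element i)))
    where
    element : Fin n → Point (n * m List.∷ [])
    element = block newest

module Definability {m} (I : Interp m) (I-linear : IsLinearInterp I) where
  open Interp I
  open Galaxies I I-linear
  open Formulas I

  Zpred⇔ℤLikeᵛ : ∀ x → Zpred x ⇔ ⟦ ℤLikeᵛ ⟧ᵛ (free x)
  Zpred⇔ℤLikeᵛ x =
    ⇔-sym (ℤType.ℤLike⇔OrderIso x) ⇔-∘ (⇔-id (D x) ×-⇔ OrderIso-cong {_<*_} Galaxy⇔Galaxyᵇ)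

  Npred⇔ℕLikeᵛ : ∀ x → Npred x ⇔ ⟦ ℕLikeᵛ _<ᵛ_ ⟧ᵛ (free x)
  Npred⇔ℕLikeᵛ x = ⇔-id (D x) ×-⇔
    (⇔-sym (Suborder.ℕLike⇔OrderIso <*-strictLinear (Galaxyᵇ x) proj₁) ⇔-∘
      OrderIso-cong {_<*_} Galaxy⇔Galaxyᵇ)

  N̄pred⇔ℕLikeᵛ : ∀ x → N̄pred x ⇔ ⟦ ℕLikeᵛ _>ᵛ_ ⟧ᵛ (free x)
  N̄pred⇔ℕLikeᵛ x = ⇔-id (D x) ×-⇔
    (⇔-sym (Suborder.ℕLike⇔OrderIso >*-strictLinear (Galaxyᵇ x) proj₁) ⇔-∘
      (OrderIso-cong {flip _<*_} Galaxy⇔Galaxyᵇ ⇔-∘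
        mk⇔ (OrderIso-flip {_<*_}) (OrderIso-flip {flip _<*_})))

  Fpred⇔cardinalityᵛ : ∀ n x → Fpred n x ⇔ ⟦ cardinalityᵛ n ⟧ᵛ (free x)
  Fpred⇔cardinalityᵛ n x = ⇔-id (D x) ×-⇔ mk⇔
    (λ (f , f∈G , f-injective , cover) → concat f ,
      (λ i → Galaxyᵇ-resp-≗ (concat-blocks f i) (to Galaxy⇔Galaxyᵇ (f∈G i))) ,
      (λ i j fi∼fj → from (⌊⌋ᵛ-sound (i Fin.≟ j) _) (f-injective i j
         (∼-resp-≗ (sym ∘ concat-blocks f i) (sym ∘ concat-blocks f j) fi∼fj))) ,
      λ b b∈G → let (i , b∼fi) = cover b (from Galaxy⇔Galaxyᵇ b∈G) in
        i , ∼-resp-≗ (λ _ → refl) (concat-blocks f i) b∼fi)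
    (λ (w , w∈G , w-injective , cover) → blocks w ,
      (λ i → from Galaxy⇔Galaxyᵇ (w∈G i)) ,
      (λ i j → to (⌊⌋ᵛ-sound (i Fin.≟ j) _) ∘ w-injective i j) ,
      λ b → cover b ∘ to Galaxy⇔Galaxyᵇ)
    where
    blocks : Vector ℕ (n * m) → Fin n → V
    blocks w i j = w (combine i j)
    concat-blocks : ∀ (f : Fin n → V) i → f i ≗ blocks (concat f) i
    concat-blocks f i j = cong (λ (i′ , j′) → f i′ j′) (sym (Fin.remQuot-combine i j))

mainTheorem3 : (m : ℕ) (I : Interp m) → IsLinearInterp I →
    Definable m (Interp.Zpred I) ×
    Definable m (Interp.Npred I) ×
    Definable m (Interp.N̄pred I) ×
    ((n : ℕ) → n ≥ 1 → Definable m (Interp.Fpred I n))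
mainTheorem3 m I I-linear =
  definable-by ℤLikeᵛ Zpred⇔ℤLikeᵛ ,
  definable-by (ℕLikeᵛ _<ᵛ_) Npred⇔ℕLikeᵛ ,
  definable-by (ℕLikeᵛ _>ᵛ_) N̄pred⇔ℕLikeᵛ ,
  λ n _ → definable-by (cardinalityᵛ n) (Fpred⇔cardinalityᵛ n)
  where
  open Formulas I
  open Definability I I-linear
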